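{- Let $m,n_1,n_2$ be positive integers with $n_1\ge m-2>n_2$ and $2\nmid mn_1$. If $$n_1>m-5+n_2+\frac{(n_2-1)^2}{m-2-n_2},$$ then $r(K_{1,m-1},S(n_1,n_2))=m-1+n_1$.
   Context: All graphs are finite simple graphs. For graphs $G_1,G_2$, the Ramsey number $r(G_1,G_2)$ is the smallest positive integer $N$ such that for every graph $G$ on $N$ vertices, either $G$ contains a (not necessarily induced) subgraph isomorphic to $G_1$, or the complement $\overline{G}$ contains a subgraph isomorphic to $G_2$. $K_{1,m-1}$ is the star on $m$ vertices. For positive integers $n_1\ge n_2$, the double star $S(n_1,n_2)$ is the tree with vertex set $\{v_0,v_1,\ldots,v_{n_1},w_0,w_1,\ldots,w_{n_2}\}$ and edge set $\{v_0v_1,\ldots,v_0v_{n_1},v_0w_0,w_0w_1,\ldots,w_0w_{n_2}\}$. -}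

module Defs where

open import Data.Nat using (ℕ; zero; suc; _≤_; _<_)
open import Data.Bool using (Bool; true; false; not)
open import Data.Fin using (Fin; zero; suc; _≟_)
open import Data.Product using (Σ; _×_)
open import Data.Sum using (_⊎_)
open import Relation.Nullary using (¬_; yes; no)
open import Relation.Binary.PropositionalEquality using (_≡_; _≢_)
open import Function.Definitions using (Injective)

record Graph (n : ℕ) : Set where
  field
    adj   : Fin n → Fin n → Bool
    sym   : ∀ i j → adj i j ≡ adj j i
    irref : ∀ i → adj i i ≡ false
open Graph public

compl-adj : ∀ {n} → Graph n → Fin n → Fin n → Bool
compl-adj G i j with i ≟ j
... | yes _ = false
... | no  _ = not (adj G i j)

-- G contains a (not necessarily induced) copy of the pattern graph H,
-- given by a vertex type V and an edge relation E:
-- an injective vertex map sending edges of H to edges of G.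
ContainsRel : ∀ {n} → (Fin n → Fin n → Bool) → (V : Set) → (V → V → Set) → Set
ContainsRel {n} A V E =
  Σ (V → Fin n) λ f → Injective _≡_ _≡_ f × (∀ x y → E x y → A (f x) (f y) ≡ true)

Contains : ∀ {n} → Graph n → (V : Set) → (V → V → Set) → Set
Contains G = ContainsRel (adj G)

ComplContains : ∀ {n} → Graph n → (V : Set) → (V → V → Set) → Set
ComplContains G = ContainsRel (compl-adj G)

Arrows : ℕ → (V₁ : Set) → (V₁ → V₁ → Set) → (V₂ : Set) → (V₂ → V₂ → Set) → Set
Arrows N V₁ E₁ V₂ E₂ = (G : Graph N) → Contains G V₁ E₁ ⊎ ComplContains G V₂ E₂

RamseyNumberIs : (V₁ : Set) → (V₁ → V₁ → Set) → (V₂ : Set) → (V₂ → V₂ → Set) → ℕ → Set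
RamseyNumberIs V₁ E₁ V₂ E₂ N =
  1 ≤ N × Arrows N V₁ E₁ V₂ E₂ × (∀ M → 1 ≤ M → M < N → ¬ Arrows M V₁ E₁ V₂ E₂)

data StarVertex (k : ℕ) : Set where
  centre : StarVertex k
  leaf   : Fin k → StarVertex k

data StarEdge (k : ℕ) : StarVertex k → StarVertex k → Set where
  cl : ∀ i → StarEdge k centre (leaf i)
  lc : ∀ i → StarEdge k (leaf i) centre

data DSVertex (n₁ n₂ : ℕ) : Set where
  v₀ : DSVertex n₁ n₂
  v  : Fin n₁ → DSVertex n₁ n₂
  w₀ : DSVertex n₁ n₂
  w  : Fin n₂ → DSVertex n₁ n₂

data DSEdge (n₁ n₂ : ℕ) : DSVertex n₁ n₂ → DSVertex n₁ n₂ → Set where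
  v₀v  : ∀ i → DSEdge n₁ n₂ v₀ (v i)
  vv₀  : ∀ i → DSEdge n₁ n₂ (v i) v₀
  v₀w₀ : DSEdge n₁ n₂ v₀ w₀
  w₀v₀ : DSEdge n₁ n₂ w₀ v₀
  w₀w  : ∀ j → DSEdge n₁ n₂ w₀ (w j)
  ww₀  : ∀ j → DSEdge n₁ n₂ (w j) w₀

module Submission where

-- Write d = m − 3; m and n₁ are odd, so N = m − 1 + n₁ and d + 1 are odd.
--
-- Let G have N vertices and no star K_{1,m−1}, so every degree is at most d + 1. By the
-- handshake lemma G is not (d + 1)-regular, so some vertex c has degree at most d and hence at least
-- n₁ + 1 nonneighbours. There are at most d² paths c – x – u with u a nonneighbour of c (each of the
-- ≤ d neighbours x of c has ≤ d further neighbours), and the numerical condition says exactly that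
-- (d − n₂ + 1)(n₁ + 1) > d²; so some nonneighbour u has at most d − n₂ common neighbours with c. Then
-- the nonneighbours of c and of u are plentiful enough for Hall's condition to pick n₁ of the former and
-- n₂ of the latter disjointly, and c, u are the centres of S(n₁, n₂) in the complement.
--
-- The (d/2)-th power of the cycle on N − 1 vertices is d-regular: it has no K_{1,m−1} and
-- its complement is n₁-regular, too sparse for the centre of S(n₁, n₂). Induced subgraphs of it handle
-- fewer vertices.

open import Defs hiding (sym)
open import Data.Bool using (Bool; true; false; not; _∧_; _∨_)
open import Data.Bool.Properties using (∨-zeroʳ; ∧-zeroʳ)
import Data.Bool as Bool
open import Data.Empty using (⊥-elim)
open import Data.Fin using (Fin; zero; suc; _≟_; toℕ; fromℕ<; inject≤; punchIn; lift; _↑ˡ_; _↑ʳ_)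
open import Data.Fin.Properties
  using (suc-injective; lift-injective; toℕ-↑ˡ; toℕ-↑ʳ; toℕ<n; toℕ-fromℕ<; toℕ-injective; any?; punchInᵢ≢i;
         inject≤-injective)
open import Data.Nat using (ℕ; zero; suc; _+_; _*_; _∸_; _^_; _≤_; _<_; z≤n; s≤s; s≤s⁻¹; _≤?_; NonZero)
open import Data.Nat.Properties hiding (_≟_; suc-injective)
open import Data.Nat.DivMod using (_%_; m%n<n; %-distribˡ-+; [m+n]%n≡m%n; n%n≡0; m<n⇒m%n≡m; m%n%n≡m%n)
open import Data.Nat.Divisibility
  using (_∣_; divides; m%n≡0⇒n∣m; ∣m⇒∣m*n; ∣n⇒∣m*n; ∣m+n∣m⇒∣n; ∣m∣n⇒∣m+n; ∣1⇒≡1)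
open import Data.Nat.Primality using (Prime; prime?; euclidsLemma)
open import Data.Nat.Solver using (module +-*-Solver)
open import Algebra.Properties.Semiring.Sum +-*-semiring
  using (sum; sum-syntax; ∑-comm; ∑-distrib-+; *-distribˡ-sum; sum-remove; sum-cong-≗; ∑-permute)
open import Data.Product using (∃; _×_; _,_; proj₁; proj₂)
open import Data.Sum using (inj₁; inj₂; [_,_]) renaming (map to ⊎-map)
open import Function using (_∘_; case_of_)
open import Data.Fin.Permutation using (permutation)
open import Function.Definitions using (Injective)
open import Relation.Binary.PropositionalEquality
  using (_≡_; _≢_; refl; sym; trans; cong; cong₂; subst; subst₂; module ≡-Reasoning)
open import Relation.Nullary using (¬_; yes; no; does)
open import Relation.Nullary.Decidable using (dec-true; dec-false; _×-dec_; from-yes)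

-- Counting elements of Fin n

indicator : Bool → ℕ
indicator true  = 1
indicator false = 0

count : ∀ {n} → (Fin n → Bool) → ℕ
count p = sum (indicator ∘ p)

_==_ : ∀ {n} → Fin n → Fin n → Bool
i == j = does (i ≟ j)

==-refl : ∀ {n} (i : Fin n) → (i == i) ≡ true
==-refl i = dec-true (i ≟ i) refl

≢⇒==-false : ∀ {n} {i j : Fin n} → i ≢ j → (i == j) ≡ false
≢⇒==-false {i = i} {j} = dec-false (i ≟ j)

∑-mono-≤ : ∀ {n} {f g : Fin n → ℕ} → (∀ i → f i ≤ g i) → sum f ≤ sum g
∑-mono-≤ {zero}  f≤g = z≤n
∑-mono-≤ {suc n} f≤g = +-mono-≤ (f≤g zero) (∑-mono-≤ (f≤g ∘ suc))

∑-const : ∀ n c → sum {n} (λ _ → c) ≡ n * c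
∑-const zero    c = refl
∑-const (suc n) c = cong (c +_) (∑-const n c)

∑-↑ : ∀ a {b} (f : Fin (a + b) → ℕ) → sum f ≡ sum (f ∘ (_↑ˡ b)) + sum (f ∘ (a ↑ʳ_))
∑-↑ zero    f = refl
∑-↑ (suc a) f = trans (cong (f zero +_) (∑-↑ a (f ∘ suc))) (sym (+-assoc (f zero) _ _))

count-true : ∀ n → count {n} (λ _ → true) ≡ n
count-true n = trans (∑-const n 1) (*-identityʳ n)

count-false : ∀ n → count {n} (λ _ → false) ≡ 0
count-false n = trans (∑-const n 0) (*-zeroʳ n)

count-== : ∀ {n} (c : Fin n) → count (c ==_) ≡ 1
count-== {suc n} c = begin
  count (c ==_)                                    ≡⟨ sum-remove {i = c} (indicator ∘ (c ==_)) ⟩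
  indicator (c == c) + count (λ j → c == punchIn c j) ≡⟨ cong₂ _+_ (cong indicator (==-refl c)) others ⟩
  1 + 0                                             ∎
  where
  open ≡-Reasoning
  others : count (λ j → c == punchIn c j) ≡ 0
  others = trans (sum-cong-≗ (λ j → cong indicator (≢⇒==-false (punchInᵢ≢i c j ∘ sym)))) (count-false n)

count-mono : ∀ {n} {p q : Fin n → Bool} → (∀ x → p x ≡ true → q x ≡ true) → count p ≤ count q
count-mono {p = p} p⊆q = ∑-mono-≤ λ x → pointwise (p x) (p⊆q x)
  where
  pointwise : ∀ {b} a → (a ≡ true → b ≡ true) → indicator a ≤ indicator b
  pointwise false _   = z≤n
  pointwise true  a⇒b rewrite a⇒b refl = ≤-refl

count-∨-≤ : ∀ {n} (p q : Fin n → Bool) → count (λ x → p x ∨ q x) ≤ count p + count q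
count-∨-≤ p q =
  ≤-trans (∑-mono-≤ λ x → pointwise (p x) (q x)) (≤-reflexive (∑-distrib-+ (indicator ∘ p) (indicator ∘ q)))
  where
  pointwise : ∀ a b → indicator (a ∨ b) ≤ indicator a + indicator b
  pointwise true  _ = s≤s z≤n
  pointwise false _ = ≤-refl

count-≤-∨ˡ : ∀ {n} (p q : Fin n → Bool) → count p ≤ count (λ x → p x ∨ q x)
count-≤-∨ˡ p q = count-mono λ x px → cong (_∨ q x) px

count-≤-∨ʳ : ∀ {n} (p q : Fin n → Bool) → count q ≤ count (λ x → p x ∨ q x)
count-≤-∨ʳ p q = count-mono λ x qx → trans (cong (p x ∨_) qx) (∨-zeroʳ (p x))

_∖_ : ∀ {n} → (Fin n → Bool) → Fin n → Fin n → Bool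
(p ∖ u) x = p x ∧ not (u == x)

count-≤-∖ : ∀ {n} (p : Fin n → Bool) u → count p ≤ count (p ∖ u) + 1
count-≤-∖ p u = begin
  count p
    ≤⟨ ∑-mono-≤ (λ x → pointwise (p x) (u == x)) ⟩
  sum (λ x → indicator ((p ∖ u) x) + indicator (u == x))
    ≡⟨ ∑-distrib-+ (indicator ∘ (p ∖ u)) (indicator ∘ (u ==_)) ⟩
  count (p ∖ u) + count (u ==_)
    ≡⟨ cong (count (p ∖ u) +_) (count-== u) ⟩
  count (p ∖ u) + 1 ∎
  where
  open ≤-Reasoning
  pointwise : ∀ a b → indicator a ≤ indicator (a ∧ not b) + indicator b
  pointwise true  true  = s≤s z≤n
  pointwise true  false = s≤s z≤n
  pointwise false _     = z≤n

∖-∈ : ∀ {n} (p : Fin n → Bool) {u x} → (p ∖ u) x ≡ true → p x ≡ true × u ≢ x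
∖-∈ p {u} {x} e with p x | u ≟ x
... | true | no u≢x = refl , u≢x

fibre-≤ : ∀ {k n} (f : Fin k → Fin n) → Injective _≡_ _≡_ f → (p : Fin n → Bool)
  → (∀ i → p (f i) ≡ true) → ∀ x → count (λ i → f i == x) ≤ indicator (p x)
fibre-≤ {zero}  f f-injective p f-∈ x = z≤n
fibre-≤ {suc k} f f-injective p f-∈ x with f zero ≟ x
... | no _ = fibre-≤ (f ∘ suc) (suc-injective ∘ f-injective) p (f-∈ ∘ suc) x
... | yes refl rewrite f-∈ zero = s≤s (≤-reflexive others)
  where
  others : count (λ i → f (suc i) == f zero) ≡ 0
  others = trans (sum-cong-≗ {k} λ i → cong indicator (≢⇒==-false λ e → case f-injective e of λ ()))
                 (count-false k)

injection⇒≤count : ∀ {k n} (f : Fin k → Fin n) → Injective _≡_ _≡_ f → (p : Fin n → Bool)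
  → (∀ i → p (f i) ≡ true) → k ≤ count p
injection⇒≤count {k} {n} f f-injective p f-∈ = begin
  k                                   ≡⟨ count-true k ⟨
  count {k} (λ _ → true)             ≡⟨ sum-cong-≗ (λ i → count-== (f i)) ⟨
  ∑[ i < k ] count (f i ==_)          ≡⟨ ∑-comm (λ i x → indicator (f i == x)) ⟩
  ∑[ x < n ] count (λ i → f i == x)   ≤⟨ ∑-mono-≤ (fibre-≤ f f-injective p f-∈) ⟩
  count p                             ∎
  where open ≤-Reasoning

-- Choosing disjoint subsets

record DisjointChoice {n} (P Q : Fin n → Bool) (a b : ℕ) : Set where
  field
    left            : Fin a → Fin n
    right           : Fin b → Fin n
    left-injective  : Injective _≡_ _≡_ left
    right-injective : Injective _≡_ _≡_ right
    disjoint        : ∀ i j → left i ≢ right j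
    left-∈          : ∀ i → P (left i) ≡ true
    right-∈         : ∀ j → Q (right j) ≡ true

module _ {n} {P Q : Fin (suc n) → Bool} {a b : ℕ} where

  skip : DisjointChoice (P ∘ suc) (Q ∘ suc) a b → DisjointChoice P Q a b
  skip C = record
    { left = suc ∘ left ; right = suc ∘ right
    ; left-injective = left-injective ∘ suc-injective
    ; right-injective = right-injective ∘ suc-injective
    ; disjoint = λ i j → disjoint i j ∘ suc-injective
    ; left-∈ = left-∈ ; right-∈ = right-∈ }
    where open DisjointChoice C

  cons-left : P zero ≡ true → DisjointChoice (P ∘ suc) (Q ∘ suc) a b → DisjointChoice P Q (suc a) b
  cons-left P0 C = record
    { left = lift 1 left ; right = suc ∘ right
    ; left-injective = lift-injective left left-injective 1
    ; right-injective = right-injective ∘ suc-injective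
    ; disjoint = λ { zero j () ; (suc i) j → disjoint i j ∘ suc-injective }
    ; left-∈ = λ { zero → P0 ; (suc i) → left-∈ i } ; right-∈ = right-∈ }
    where open DisjointChoice C

  cons-right : Q zero ≡ true → DisjointChoice (P ∘ suc) (Q ∘ suc) a b → DisjointChoice P Q a (suc b)
  cons-right Q0 C = record
    { left = suc ∘ left ; right = lift 1 right
    ; left-injective = left-injective ∘ suc-injective
    ; right-injective = lift-injective right right-injective 1
    ; disjoint = λ { i zero () ; i (suc j) → disjoint i j ∘ suc-injective }
    ; left-∈ = left-∈ ; right-∈ = λ { zero → Q0 ; (suc j) → right-∈ j } }
    where open DisjointChoice C

module _ {n} {P Q : Fin (suc n) → Bool}
  (choose-tail : ∀ {a b} → a ≤ count (P ∘ suc) → b ≤ count (Q ∘ suc)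
                 → a + b ≤ count (λ x → P (suc x) ∨ Q (suc x)) → DisjointChoice (P ∘ suc) (Q ∘ suc) a b)
  where

  choose-right : ∀ {a b} → Q zero ≡ true → a ≤ count (P ∘ suc) → b ≤ suc (count (Q ∘ suc))
    → a + b ≤ suc (count (λ x → P (suc x) ∨ Q (suc x))) → DisjointChoice P Q a b
  choose-right {a} {zero} Q0 a≤ _ _ =
    skip (choose-tail a≤ z≤n (subst (_≤ _) (sym (+-identityʳ a)) (≤-trans a≤ (count-≤-∨ˡ (P ∘ suc) (Q ∘ suc)))))
  choose-right {a} {suc b} Q0 a≤ (s≤s b≤) a+b≤ =
    cons-right Q0 (choose-tail a≤ b≤ (s≤s⁻¹ (subst (_≤ suc (count (λ x → P (suc x) ∨ Q (suc x)))) (+-suc a b) a+b≤)))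

  choose-left : ∀ {a b} → P zero ≡ true → a ≤ suc (count (P ∘ suc)) → b ≤ count (Q ∘ suc)
    → a + b ≤ suc (count (λ x → P (suc x) ∨ Q (suc x))) → DisjointChoice P Q a b
  choose-left {zero}  P0 _        b≤ _          = skip (choose-tail z≤n b≤ (≤-trans b≤ (count-≤-∨ʳ (P ∘ suc) (Q ∘ suc))))
  choose-left {suc a} P0 (s≤s a≤) b≤ (s≤s a+b≤) = cons-left P0 (choose-tail a≤ b≤ a+b≤)

disjoint-choice : ∀ {n} (P Q : Fin n → Bool) {a b : ℕ} → a ≤ count P → b ≤ count Q
  → a + b ≤ count (λ x → P x ∨ Q x) → DisjointChoice P Q a b
disjoint-choice {zero} P Q z≤n z≤n _ = record
  { left = λ () ; right = λ () ; left-injective = λ { {()} } ; right-injective = λ { {()} }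
  ; disjoint = λ () ; left-∈ = λ () ; right-∈ = λ () }
disjoint-choice {suc n} P Q {a} {b} a≤ b≤ a+b≤ with P zero in P0 | Q zero in Q0
... | false | false = skip (disjoint-choice (P ∘ suc) (Q ∘ suc) a≤ b≤ a+b≤)
... | false | true  = choose-right (disjoint-choice (P ∘ suc) (Q ∘ suc)) Q0 a≤ b≤ a+b≤
... | true  | false = choose-left (disjoint-choice (P ∘ suc) (Q ∘ suc)) P0 a≤ b≤ a+b≤
... | true  | true  with a ≤? count (P ∘ suc)
...   | yes a≤′ = choose-right (disjoint-choice (P ∘ suc) (Q ∘ suc)) Q0 a≤′ b≤ a+b≤
...   | no  a≰′ = choose-left (disjoint-choice (P ∘ suc) (Q ∘ suc)) P0 a≤ b≤′ a+b≤
  where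
  open ≤-Reasoning
  -- a exceeds what the tail of P can supply, so vertex zero must go to the left part.
  b≤′ : b ≤ count (Q ∘ suc)
  b≤′ = +-cancelˡ-≤ (suc (count (P ∘ suc))) b (count (Q ∘ suc)) (begin
    suc (count (P ∘ suc)) + b                       ≡⟨ cong (_+ b) (≤-antisym a≤ (≰⇒> a≰′)) ⟨
    a + b                                           ≤⟨ a+b≤ ⟩
    suc (count (λ x → P (suc x) ∨ Q (suc x)))       ≤⟨ s≤s (count-∨-≤ (P ∘ suc) (Q ∘ suc)) ⟩
    suc (count (P ∘ suc) + count (Q ∘ suc))         ∎)

-- Degrees, complements and embedded stars

adj⇒≢ : ∀ {n} (G : Graph n) {i j} → adj G i j ≡ true → i ≢ j
adj⇒≢ G {i} e refl with () ← trans (sym (irref G i)) e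

compl-adj-irrefl : ∀ {n} (G : Graph n) i → compl-adj G i i ≡ false
compl-adj-irrefl G i with i ≟ i
... | yes _   = refl
... | no  i≢i = ⊥-elim (i≢i refl)

compl-adj-≢ : ∀ {n} (G : Graph n) {i j} → i ≢ j → compl-adj G i j ≡ not (adj G i j)
compl-adj-≢ G {i} {j} i≢j with i ≟ j
... | yes i≡j = ⊥-elim (i≢j i≡j)
... | no  _   = refl

compl-adj-sym : ∀ {n} (G : Graph n) i j → compl-adj G i j ≡ compl-adj G j i
compl-adj-sym G i j with i ≟ j
... | yes refl = sym (compl-adj-irrefl G i)
... | no  i≢j  = trans (cong not (Graph.sym G i j)) (sym (compl-adj-≢ G (i≢j ∘ sym)))

complement : ∀ {n} → Graph n → Graph n
complement G = record { adj = compl-adj G ; sym = compl-adj-sym G ; irref = compl-adj-irrefl G }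

degree : ∀ {n} → Graph n → Fin n → ℕ
degree G c = count (adj G c)

codegree : ∀ {n} → Graph n → Fin n → Fin n → ℕ
codegree G c u = count (λ x → adj G c x ∧ adj G u x)

degree-complement : ∀ {n} (G : Graph n) c → degree (complement G) c + degree G c + 1 ≡ n
degree-complement {n} G c = begin
  degree (complement G) c + degree G c + 1
    ≡⟨ cong (degree (complement G) c + degree G c +_) (count-== c) ⟨
  count (compl-adj G c) + count (adj G c) + count (c ==_)
    ≡⟨ cong (_+ count (c ==_)) (∑-distrib-+ (indicator ∘ compl-adj G c) (indicator ∘ adj G c)) ⟨
  ∑[ x < n ] (indicator (compl-adj G c x) + indicator (adj G c x)) + count (c ==_)
    ≡⟨ ∑-distrib-+ (λ x → indicator (compl-adj G c x) + indicator (adj G c x)) (indicator ∘ (c ==_)) ⟨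
  ∑[ x < n ] (indicator (compl-adj G c x) + indicator (adj G c x) + indicator (c == x))
    ≡⟨ sum-cong-≗ one-of-three ⟩
  count {n} (λ _ → true)
    ≡⟨ count-true n ⟩
  n ∎
  where
  open ≡-Reasoning
  one-of-three : ∀ x → indicator (compl-adj G c x) + indicator (adj G c x) + indicator (c == x) ≡ 1
  one-of-three x with c ≟ x
  ... | yes refl rewrite irref G c = refl
  ... | no  _    with adj G c x
  ...   | true  = refl
  ...   | false = refl

degree-complement-≥ : ∀ {n e k} (G : Graph n) c → degree G c ≤ e → e + k < n → k ≤ degree (complement G) c
degree-complement-≥ {n} {e} {k} G c deg≤ e+k<n = +-cancelˡ-≤ e k h (s≤s⁻¹ (begin
  suc (e + k)                ≤⟨ e+k<n ⟩
  n                          ≡⟨ degree-complement G c ⟨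
  h + degree G c + 1         ≤⟨ +-monoˡ-≤ 1 (+-monoʳ-≤ h deg≤) ⟩
  h + e + 1                  ≡⟨ solve 2 (λ h e → h :+ e :+ con 1 := con 1 :+ (e :+ h)) refl h e ⟩
  suc (e + h)                ∎))
  where
  open ≤-Reasoning
  open +-*-Solver
  h = degree (complement G) c

symmetric-sum-even : ∀ {n} (a : Fin n → Fin n → ℕ) → (∀ i j → a i j ≡ a j i) → (∀ i → a i i ≡ 0)
  → 2 ∣ ∑[ i < n ] ∑[ j < n ] a i j
symmetric-sum-even {zero}  a a-sym a-diag = divides 0 refl
symmetric-sum-even {suc n} a a-sym a-diag
  with divides k inner ← symmetric-sum-even (λ i j → a (suc i) (suc j)) (λ i j → a-sym (suc i) (suc j)) (a-diag ∘ suc)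
  = divides (row + k) (begin
    a zero zero + row + ∑[ i < n ] (a (suc i) zero + ∑[ j < n ] a (suc i) (suc j))
      ≡⟨ cong₂ (λ d s → d + row + s) (a-diag zero) (∑-distrib-+ (λ i → a (suc i) zero) _) ⟩
    row + (∑[ i < n ] a (suc i) zero + ∑[ i < n ] ∑[ j < n ] a (suc i) (suc j))
      ≡⟨ cong₂ (λ col s → row + (col + s)) (sum-cong-≗ (λ i → a-sym (suc i) zero)) inner ⟩
    row + (row + k * 2)
      ≡⟨ solve 2 (λ r k → r :+ (r :+ k :* con 2) := (r :+ k) :* con 2) refl row k ⟩
    (row + k) * 2 ∎)
  where
  open ≡-Reasoning
  open +-*-Solver
  row = ∑[ j < n ] a zero (suc j)

handshake : ∀ {n} (G : Graph n) → 2 ∣ ∑[ c < n ] degree G c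
handshake G = symmetric-sum-even (λ i j → indicator (adj G i j))
  (λ i j → cong indicator (Graph.sym G i j)) (λ i → cong indicator (irref G i))

low-degree-vertex : ∀ {n k} (G : Graph n) → ¬ 2 ∣ n * k → (∀ c → degree G c ≤ k) → ∃ λ c → degree G c < k
low-degree-vertex {n} {k} G odd Δ≤k with any? (λ c → suc (degree G c) ≤? k)
... | yes below = below
... | no  none  = ⊥-elim (odd (subst (2 ∣_) degree-sum (handshake G)))
  where
  degree-sum : ∑[ c < n ] degree G c ≡ n * k
  degree-sum = trans (sum-cong-≗ λ c → ≤-antisym (Δ≤k c) (≮⇒≥ λ d<k → none (c , d<k))) (∑-const n k)

star-of-degree : ∀ {n k} (G : Graph n) c → k ≤ degree G c → Contains G (StarVertex k) (StarEdge k)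
star-of-degree {k = k} G c k≤deg = embed , embed-injective , embed-edge
  where
  open DisjointChoice (disjoint-choice (adj G c) (λ _ → false) k≤deg z≤n
    (≤-trans (≤-reflexive (+-identityʳ k)) (≤-trans k≤deg (count-≤-∨ˡ (adj G c) (λ _ → false)))))
  embed : StarVertex k → Fin _
  embed centre   = c
  embed (leaf i) = left i
  embed-injective : Injective _≡_ _≡_ embed
  embed-injective {centre} {centre} _ = refl
  embed-injective {centre} {leaf j} e = ⊥-elim (adj⇒≢ G (left-∈ j) e)
  embed-injective {leaf i} {centre} e = ⊥-elim (adj⇒≢ G (left-∈ i) (sym e))
  embed-injective {leaf i} {leaf j} e = cong leaf (left-injective e)
  embed-edge : ∀ x y → StarEdge k x y → adj G (embed x) (embed y) ≡ true
  embed-edge _ _ (cl i) = left-∈ i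
  embed-edge _ _ (lc i) = trans (Graph.sym G (left i) c) (left-∈ i)

degree-of-star : ∀ {n k} (G : Graph n) → Contains G (StarVertex k) (StarEdge k) → ∃ λ c → k ≤ degree G c
degree-of-star G (f , f-injective , f-edge) =
  f centre , injection⇒≤count (f ∘ leaf) (leaf-injective ∘ f-injective) (adj G (f centre)) (λ i → f-edge _ _ (cl i))
  where
  leaf-injective : ∀ {k} {i j : Fin k} → leaf {k} i ≡ leaf j → i ≡ j
  leaf-injective refl = refl

double-star-of-choice : ∀ {n n₁ n₂} (H : Graph n) {c u} → adj H c u ≡ true
  → DisjointChoice (adj H c ∖ u) (adj H u ∖ c) n₁ n₂ → Contains H (DSVertex n₁ n₂) (DSEdge n₁ n₂)
double-star-of-choice {n₁ = n₁} {n₂} H {c} {u} cu C = embed , embed-injective , embed-edge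
  where
  open DisjointChoice C
  c≢u : c ≢ u
  c≢u = adj⇒≢ H cu
  c-left : ∀ i → adj H c (left i) ≡ true
  c-left i = proj₁ (∖-∈ (adj H c) {u} (left-∈ i))
  u-right : ∀ j → adj H u (right j) ≡ true
  u-right j = proj₁ (∖-∈ (adj H u) {c} (right-∈ j))
  c≢left : ∀ i → c ≢ left i
  c≢left i = adj⇒≢ H (c-left i)
  u≢left : ∀ i → u ≢ left i
  u≢left i = proj₂ (∖-∈ (adj H c) {u} (left-∈ i))
  c≢right : ∀ j → c ≢ right j
  c≢right j = proj₂ (∖-∈ (adj H u) {c} (right-∈ j))
  u≢right : ∀ j → u ≢ right j
  u≢right j = adj⇒≢ H (u-right j)
  embed : DSVertex n₁ n₂ → Fin _
  embed v₀    = c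
  embed (v i) = left i
  embed w₀    = u
  embed (w j) = right j
  embed-injective : Injective _≡_ _≡_ embed
  embed-injective {v₀}  {v₀}  e = refl
  embed-injective {v₀}  {v j} e = ⊥-elim (c≢left j e)
  embed-injective {v₀}  {w₀}  e = ⊥-elim (c≢u e)
  embed-injective {v₀}  {w j} e = ⊥-elim (c≢right j e)
  embed-injective {v i} {v₀}  e = ⊥-elim (c≢left i (sym e))
  embed-injective {v i} {v j} e = cong v (left-injective e)
  embed-injective {v i} {w₀}  e = ⊥-elim (u≢left i (sym e))
  embed-injective {v i} {w j} e = ⊥-elim (disjoint i j e)
  embed-injective {w₀}  {v₀}  e = ⊥-elim (c≢u (sym e))
  embed-injective {w₀}  {v j} e = ⊥-elim (u≢left j e)
  embed-injective {w₀}  {w₀}  e = refl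
  embed-injective {w₀}  {w j} e = ⊥-elim (u≢right j e)
  embed-injective {w i} {v₀}  e = ⊥-elim (c≢right i (sym e))
  embed-injective {w i} {v j} e = ⊥-elim (disjoint j i (sym e))
  embed-injective {w i} {w₀}  e = ⊥-elim (u≢right i (sym e))
  embed-injective {w i} {w j} e = cong w (right-injective e)
  embed-edge : ∀ x y → DSEdge n₁ n₂ x y → adj H (embed x) (embed y) ≡ true
  embed-edge _ _ (v₀v i) = c-left i
  embed-edge _ _ (vv₀ i) = trans (Graph.sym H (left i) c) (c-left i)
  embed-edge _ _ v₀w₀    = cu
  embed-edge _ _ w₀v₀    = trans (Graph.sym H u c) cu
  embed-edge _ _ (w₀w j) = u-right j
  embed-edge _ _ (ww₀ j) = trans (Graph.sym H (right j) u) (u-right j)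

degree-of-double-star : ∀ {n n₁ n₂} (H : Graph n) → Contains H (DSVertex n₁ n₂) (DSEdge n₁ n₂)
  → ∃ λ c → suc n₁ ≤ degree H c
degree-of-double-star {n₁ = n₁} {n₂} H (f , f-injective , f-edge) =
  f v₀ , injection⇒≤count g g-injective (adj H (f v₀)) g-edge
  where
  g : Fin (suc n₁) → Fin _
  g zero    = f w₀
  g (suc i) = f (v i)
  g-injective : Injective _≡_ _≡_ g
  g-injective {zero}  {zero}  _ = refl
  g-injective {zero}  {suc j} e with () ← f-injective e
  g-injective {suc i} {zero}  e with () ← f-injective e
  g-injective {suc i} {suc j} e with refl ← f-injective e = refl
  g-edge : ∀ i → adj H (f v₀) (g i) ≡ true
  g-edge zero    = f-edge _ _ v₀w₀
  g-edge (suc i) = f-edge _ _ (v₀v i)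

induced : ∀ {M K} → (Fin M → Fin K) → Graph K → Graph M
induced ι G = record
  { adj = λ i j → adj G (ι i) (ι j) ; sym = λ i j → Graph.sym G (ι i) (ι j) ; irref = irref G ∘ ι }

compl-adj-induced : ∀ {M K} {ι : Fin M → Fin K} → Injective _≡_ _≡_ ι → (G : Graph K) → ∀ i j
  → compl-adj (induced ι G) i j ≡ compl-adj G (ι i) (ι j)
compl-adj-induced {ι = ι} ι-injective G i j with i ≟ j
... | yes refl = sym (compl-adj-irrefl G (ι i))
... | no  i≢j  = sym (compl-adj-≢ G (i≢j ∘ ι-injective))

contains-comap : ∀ {M K} {A : Fin M → Fin M → Bool} {B : Fin K → Fin K → Bool} {V : Set} {E : V → V → Set}
  (ι : Fin M → Fin K) → Injective _≡_ _≡_ ι → (∀ i j → A i j ≡ B (ι i) (ι j))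
  → ContainsRel A V E → ContainsRel B V E
contains-comap ι ι-injective A≡B (f , f-injective , f-edge) =
  ι ∘ f , f-injective ∘ ι-injective , λ x y e → trans (sym (A≡B (f x) (f y))) (f-edge x y e)

arrows-mono : ∀ {M K V₁ E₁ V₂ E₂} → M ≤ K → Arrows M V₁ E₁ V₂ E₂ → Arrows K V₁ E₁ V₂ E₂
arrows-mono {M} {K} M≤K arrows G = ⊎-map
  (contains-comap {B = adj G} ι ι-injective (λ _ _ → refl))
  (contains-comap {B = compl-adj G} ι ι-injective (compl-adj-induced ι-injective G))
  (arrows (induced ι G))
  where
  ι : Fin M → Fin K
  ι i = inject≤ i M≤K
  ι-injective : Injective _≡_ _≡_ ι
  ι-injective = inject≤-injective M≤K M≤K _ _

-- The upper bound

codegree-sum-≤ : ∀ {n d} (G : Graph n) c → (∀ x → degree G x ≤ suc d)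
  → ∑[ u < n ] count (λ x → compl-adj G c u ∧ (adj G c x ∧ adj G u x)) ≤ d * degree G c
codegree-sum-≤ {n} {d} G c Δ≤ = begin
  ∑[ u < n ] ∑[ x < n ] F u x   ≡⟨ ∑-comm F ⟩
  ∑[ x < n ] ∑[ u < n ] F u x   ≤⟨ ∑-mono-≤ column-≤ ⟩
  ∑[ x < n ] (d * indicator (adj G c x)) ≡⟨ *-distribˡ-sum d (indicator ∘ adj G c) ⟨
  d * degree G c                ∎
  where
  open ≤-Reasoning
  F : Fin n → Fin n → ℕ
  F u x = indicator (compl-adj G c u ∧ (adj G c x ∧ adj G u x))
  -- c itself is a neighbour of x that is not a nonneighbour of c, hence the bound d rather than d + 1.
  entry-≤ : ∀ x u → adj G c x ≡ true
    → indicator (compl-adj G c u ∧ adj G u x) + indicator (c == u) ≤ indicator (adj G x u)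
  entry-≤ x u cx with c ≟ u
  ... | yes refl rewrite Graph.sym G x c | cx = ≤-refl
  ... | no  _    rewrite Graph.sym G x u with adj G c u | adj G u x
  ...   | false | true  = ≤-refl
  ...   | false | false = z≤n
  ...   | true  | _     = z≤n
  column-≤ : ∀ x → ∑[ u < n ] F u x ≤ d * indicator (adj G c x)
  column-≤ x with adj G c x in cx
  ... | false = ≤-reflexive (trans (sum-cong-≗ {n} (λ u → cong indicator (∧-zeroʳ (compl-adj G c u))))
                                   (trans (count-false n) (sym (*-zeroʳ d))))
  ... | true  = ≤-trans (s≤s⁻¹ (begin
    suc (count R)                         ≡⟨ +-comm 1 (count R) ⟩
    count R + 1                           ≡⟨ cong (count R +_) (count-== c) ⟨
    count R + count (c ==_)               ≡⟨ ∑-distrib-+ (indicator ∘ R) (indicator ∘ (c ==_)) ⟨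
    ∑[ u < n ] (indicator (R u) + indicator (c == u)) ≤⟨ ∑-mono-≤ (λ u → entry-≤ x u cx) ⟩
    degree G x                                     ≤⟨ Δ≤ x ⟩
    suc d                                          ∎)) (≤-reflexive (sym (*-identityʳ d)))
    where
    R : Fin n → Bool
    R u = compl-adj G c u ∧ adj G u x

nonneighbour-of-small-codegree : ∀ {n d n₁ t} (G : Graph n) c → (∀ x → degree G x ≤ suc d) → degree G c ≤ d
  → suc n₁ ≤ degree (complement G) c → d * d < t * suc n₁
  → ∃ λ u → compl-adj G c u ≡ true × codegree G c u < t
nonneighbour-of-small-codegree {n} {d} {n₁} {t} G c Δ≤ deg-c≤ n₁<compl-deg dd<
  with any? (λ u → (compl-adj G c u Bool.≟ true) ×-dec (suc (codegree G c u) ≤? t))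
... | yes found = found
... | no  none  = ⊥-elim (<⇒≱ dd< (begin
  t * suc n₁                    ≤⟨ *-monoʳ-≤ t n₁<compl-deg ⟩
  t * degree (complement G) c   ≡⟨ *-distribˡ-sum t (indicator ∘ compl-adj G c) ⟩
  ∑[ u < n ] (t * indicator (compl-adj G c u)) ≤⟨ ∑-mono-≤ row-≥ ⟩
  ∑[ u < n ] count (λ x → compl-adj G c u ∧ (adj G c x ∧ adj G u x)) ≤⟨ codegree-sum-≤ G c Δ≤ ⟩
  d * degree G c                ≤⟨ *-monoʳ-≤ d deg-c≤ ⟩
  d * d                         ∎))
  where
  open ≤-Reasoning
  row-≥ : ∀ u → t * indicator (compl-adj G c u) ≤ count (λ x → compl-adj G c u ∧ (adj G c x ∧ adj G u x))
  row-≥ u with compl-adj G c u in cu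
  ... | false = ≤-trans (≤-reflexive (*-zeroʳ t)) z≤n
  ... | true  = ≤-trans (≤-reflexive (*-identityʳ t)) (≮⇒≥ λ small → none (u , cu , small))

vertices-≤ : ∀ {n} (G : Graph n) c u
  → n ≤ 2 + count (λ x → (compl-adj G c ∖ u) x ∨ (compl-adj G u ∖ c) x) + codegree G c u
vertices-≤ {n} G c u = begin
  n                                                       ≡⟨ count-true n ⟨
  count {n} (λ _ → true)                                  ≤⟨ ∑-mono-≤ covered ⟩
  ∑[ x < n ] (indicator (u == x) + indicator (c == x) + indicator (R x) + indicator (common x))
    ≡⟨ ∑-distrib-+ (λ x → indicator (u == x) + indicator (c == x) + indicator (R x)) (indicator ∘ common) ⟩
  ∑[ x < n ] (indicator (u == x) + indicator (c == x) + indicator (R x)) + codegree G c u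
    ≡⟨ cong (_+ codegree G c u) (∑-distrib-+ (λ x → indicator (u == x) + indicator (c == x)) (indicator ∘ R)) ⟩
  ∑[ x < n ] (indicator (u == x) + indicator (c == x)) + count R + codegree G c u
    ≡⟨ cong (λ s → s + count R + codegree G c u)
         (trans (∑-distrib-+ (indicator ∘ (u ==_)) (indicator ∘ (c ==_))) (cong₂ _+_ (count-== u) (count-== c))) ⟩
  2 + count R + codegree G c u                            ∎
  where
  open ≤-Reasoning
  R common : Fin n → Bool
  R x = (compl-adj G c ∖ u) x ∨ (compl-adj G u ∖ c) x
  common x = adj G c x ∧ adj G u x
  covered : ∀ x → 1 ≤ indicator (u == x) + indicator (c == x) + indicator (R x) + indicator (common x)
  covered x with u ≟ x | c ≟ x
  ... | yes _    | _        = s≤s z≤n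
  ... | no  _    | yes _    = s≤s z≤n
  ... | no  _    | no  _    with adj G c x | adj G u x
  ...   | true  | true  = s≤s z≤n
  ...   | true  | false = s≤s z≤n
  ...   | false | _     = s≤s z≤n

double-star-in-complement : ∀ {d n₁ n₂} (G : Graph (2 + d + n₁)) {c u} → n₂ ≤ d → n₂ < n₁
  → suc n₁ ≤ degree (complement G) c → n₁ ≤ degree (complement G) u
  → compl-adj G c u ≡ true → codegree G c u ≤ d ∸ n₂
  → ComplContains G (DSVertex n₁ n₂) (DSEdge n₁ n₂)
double-star-in-complement {d} {n₁} {n₂} G {c} {u} n₂≤d n₂<n₁ n₁<deg-c n₁≤deg-u cu codeg≤ =
  double-star-of-choice (complement G) {c} {u} cu (disjoint-choice P Q n₁≤P n₂≤Q n₁+n₂≤P∨Q)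
  where
  open ≤-Reasoning
  open +-*-Solver
  P Q : Fin (2 + d + n₁) → Bool
  P = compl-adj G c ∖ u
  Q = compl-adj G u ∖ c
  n₁≤P : n₁ ≤ count P
  n₁≤P = +-cancelʳ-≤ 1 n₁ (count P)
    (≤-trans (≤-reflexive (+-comm n₁ 1)) (≤-trans n₁<deg-c (count-≤-∖ (compl-adj G c) u)))
  n₂≤Q : n₂ ≤ count Q
  n₂≤Q = +-cancelʳ-≤ 1 n₂ (count Q)
    (≤-trans (≤-reflexive (+-comm n₂ 1)) (≤-trans n₂<n₁ (≤-trans n₁≤deg-u (count-≤-∖ (compl-adj G u) c))))
  n₁+n₂≤P∨Q : n₁ + n₂ ≤ count (λ x → P x ∨ Q x)
  n₁+n₂≤P∨Q = +-cancelʳ-≤ (2 + (d ∸ n₂)) (n₁ + n₂) U (begin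
    n₁ + n₂ + (2 + (d ∸ n₂))
      ≡⟨ solve 3 (λ n₁ n₂ e → n₁ :+ n₂ :+ (con 2 :+ e) := con 2 :+ (n₂ :+ e) :+ n₁) refl n₁ n₂ (d ∸ n₂) ⟩
    2 + (n₂ + (d ∸ n₂)) + n₁      ≡⟨ cong (λ d′ → 2 + d′ + n₁) (m+[n∸m]≡n n₂≤d) ⟩
    2 + d + n₁                    ≤⟨ vertices-≤ G c u ⟩
    2 + U + codegree G c u        ≤⟨ +-monoʳ-≤ (2 + U) codeg≤ ⟩
    2 + U + (d ∸ n₂)              ≡⟨ solve 2 (λ U e → con 2 :+ U :+ e := U :+ (con 2 :+ e)) refl U (d ∸ n₂) ⟩
    U + (2 + (d ∸ n₂))            ∎)
    where
    U = count (λ x → P x ∨ Q x)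

complement-double-star-of-bounded-degree : ∀ {d n₁ n₂} (G : Graph (2 + d + n₁)) → n₂ ≤ d → n₂ < n₁
  → ¬ 2 ∣ (2 + d + n₁) * suc d → d * d < suc (d ∸ n₂) * suc n₁ → (∀ x → degree G x ≤ suc d)
  → ComplContains G (DSVertex n₁ n₂) (DSEdge n₁ n₂)
complement-double-star-of-bounded-degree {d} {n₁} G n₂≤d n₂<n₁ odd dd< Δ≤
  with c , deg-c< ← low-degree-vertex G odd Δ≤
  with n₁<deg-c ← degree-complement-≥ G c (s≤s⁻¹ deg-c<) (≤-reflexive (cong suc (+-suc d n₁)))
  with u , cu , codeg< ← nonneighbour-of-small-codegree G c Δ≤ (s≤s⁻¹ deg-c<) n₁<deg-c dd<
  = double-star-in-complement G n₂≤d n₂<n₁ n₁<deg-c n₁≤deg-u cu (s≤s⁻¹ codeg<)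
  where
  n₁≤deg-u = degree-complement-≥ G u (Δ≤ u) ≤-refl

arrows-upper-bound : ∀ d n₁ n₂ → n₂ ≤ d → n₂ < n₁
  → ¬ 2 ∣ (2 + d + n₁) * suc d → d * d < suc (d ∸ n₂) * suc n₁
  → Arrows (2 + d + n₁) (StarVertex (2 + d)) (StarEdge (2 + d)) (DSVertex n₁ n₂) (DSEdge n₁ n₂)
arrows-upper-bound d n₁ n₂ n₂≤d n₂<n₁ odd dd< G with any? (λ c → 2 + d ≤? degree G c)
... | yes (c , big) = inj₁ (star-of-degree G c big)
... | no  none      = inj₂ (complement-double-star-of-bounded-degree G n₂≤d n₂<n₁ odd dd< Δ≤)
  where
  Δ≤ : ∀ x → degree G x ≤ suc d
  Δ≤ x = s≤s⁻¹ (≰⇒> λ big → none (x , big))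

%-absorbˡ : ∀ a b n .{{_ : NonZero n}} → (a % n + b) % n ≡ (a + b) % n
%-absorbˡ a b n = begin
  (a % n + b) % n           ≡⟨ %-distribˡ-+ (a % n) b n ⟩
  (a % n % n + b % n) % n   ≡⟨ cong (λ y → (y + b % n) % n) (m%n%n≡m%n a n) ⟩
  (a % n + b % n) % n       ≡⟨ %-distribˡ-+ a b n ⟨
  (a + b) % n               ∎
  where open ≡-Reasoning

rotate : ∀ {n} .{{_ : NonZero n}} → ℕ → Fin n → Fin n
rotate {n} s x = fromℕ< (m%n<n (toℕ x + s) n)

rotate-inverse : ∀ {n} .{{_ : NonZero n}} {s s′} → s + s′ ≡ n → ∀ x → rotate s′ (rotate s x) ≡ x
rotate-inverse {n} {s} {s′} s+s′≡n x = toℕ-injective (begin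
  toℕ (rotate s′ (rotate s x))  ≡⟨ toℕ-fromℕ< (m%n<n (toℕ (rotate s x) + s′) n) ⟩
  (toℕ (rotate s x) + s′) % n   ≡⟨ cong (λ y → (y + s′) % n) (toℕ-fromℕ< (m%n<n (toℕ x + s) n)) ⟩
  ((toℕ x + s) % n + s′) % n    ≡⟨ %-absorbˡ (toℕ x + s) s′ n ⟩
  (toℕ x + s + s′) % n          ≡⟨ cong (_% n) (trans (+-assoc (toℕ x) s s′) (cong (toℕ x +_) s+s′≡n)) ⟩
  (toℕ x + n) % n               ≡⟨ [m+n]%n≡m%n (toℕ x) n ⟩
  toℕ x % n                     ≡⟨ m<n⇒m%n≡m (toℕ<n x) ⟩
  toℕ x                         ∎)
  where open ≡-Reasoning

-- Powers of cycles: the lower bound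

-- The r-th power of the cycle on K = 2r + L + 1 vertices: c and x are adjacent iff the offset
-- (x − c) mod K lies in [1, r] or in [K − r, K − 1].
module CyclePower (r L : ℕ) where

  K : ℕ
  K = suc (r + L + r)

  window : ℕ → Bool
  window y = (does (1 ≤? y) ∧ does (y ≤? r)) ∨ does (suc (r + L) ≤? y)

  window-near : ∀ {y} → 1 ≤ y → y ≤ r → window y ≡ true
  window-near {y} 1≤y y≤r rewrite dec-true (1 ≤? y) 1≤y | dec-true (y ≤? r) y≤r = refl

  window-far : ∀ {y} → suc (r + L) ≤ y → window y ≡ true
  window-far {y} far rewrite dec-true (suc (r + L) ≤? y) far = ∨-zeroʳ _

  window-gap : ∀ {y} → r < y → y < suc (r + L) → window y ≡ false
  window-gap {y} r<y y<far rewrite dec-false (y ≤? r) (<⇒≱ r<y) | dec-false (suc (r + L) ≤? y) (<⇒≱ y<far)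
    = cong (_∨ false) (∧-zeroʳ (does (1 ≤? y)))

  count-window : count {K} (window ∘ toℕ) ≡ r + r
  count-window = begin
    count {K} (window ∘ toℕ)
      ≡⟨ ∑-↑ (r + L) f ⟩
    sum (f ∘ (_↑ˡ r)) + sum (f ∘ ((r + L) ↑ʳ_))
      ≡⟨ cong (_+ sum (f ∘ ((r + L) ↑ʳ_))) (∑-↑ r (f ∘ (_↑ˡ r))) ⟩
    sum (f ∘ (_↑ˡ r) ∘ (_↑ˡ L)) + sum (f ∘ (_↑ˡ r) ∘ (r ↑ʳ_)) + sum (f ∘ ((r + L) ↑ʳ_))
      ≡⟨ cong₂ (λ near gap → near + gap + sum (f ∘ ((r + L) ↑ʳ_))) (sum-cong-≗ near) (sum-cong-≗ gap) ⟩
    sum {r} (λ _ → 1) + sum {L} (λ _ → 0) + sum (f ∘ ((r + L) ↑ʳ_))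
      ≡⟨ cong₂ (λ z far → sum {r} (λ _ → 1) + z + far) (count-false L) (sum-cong-≗ far) ⟩
    count {r} (λ _ → true) + 0 + count {r} (λ _ → true)
      ≡⟨ cong₂ (λ a b → a + 0 + b) (count-true r) (count-true r) ⟩
    r + 0 + r
      ≡⟨ cong (_+ r) (+-identityʳ r) ⟩
    r + r ∎
    where
    open ≡-Reasoning
    f : Fin (r + L + r) → ℕ
    f y = indicator (window (suc (toℕ y)))
    near : ∀ y → f ((y ↑ˡ L) ↑ˡ r) ≡ 1
    near y rewrite toℕ-↑ˡ (y ↑ˡ L) r | toℕ-↑ˡ y L = cong indicator (window-near (s≤s z≤n) (toℕ<n y))
    gap : ∀ y → f ((r ↑ʳ y) ↑ˡ r) ≡ 0
    gap y rewrite toℕ-↑ˡ (r ↑ʳ y) r | toℕ-↑ʳ r y =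
      cong indicator (window-gap (s≤s (m≤m+n r (toℕ y))) (s≤s (+-monoʳ-< r (toℕ<n y))))
    far : ∀ y → f ((r + L) ↑ʳ y) ≡ 1
    far y rewrite toℕ-↑ʳ (r + L) y = cong indicator (window-far (s≤s (m≤m+n (r + L) (toℕ y))))

  window-reflect : ∀ {y} → 0 < y → y < K → window (K ∸ y) ≡ window y
  window-reflect {y} 0<y y<K with y ≤? r
  ... | yes y≤r = trans (window-far (subst (_≤ K ∸ y) (m+n∸n≡m (suc (r + L)) r) (∸-monoʳ-≤ K y≤r)))
                        (sym (window-near 0<y y≤r))
  ... | no  y≰r with y ≤? r + L
  ...   | yes y≤r+L = trans (window-gap r<K∸y K∸y<far) (sym (window-gap (≰⇒> y≰r) (s≤s y≤r+L)))
    where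
    r<K∸y : r < K ∸ y
    r<K∸y = subst (_≤ K ∸ y) (trans (cong (_∸ (r + L)) (sym (+-suc (r + L) r))) (m+n∸m≡n (r + L) (suc r)))
                  (∸-monoʳ-≤ K y≤r+L)
    K∸y<far : K ∸ y < suc (r + L)
    K∸y<far = s≤s (subst (K ∸ y ≤_) (m+n∸n≡m (r + L) r) (∸-monoʳ-≤ K (≰⇒> y≰r)))
  ...   | no  y≰r+L =
    trans (window-near (m<n⇒0<n∸m y<K) (subst (K ∸ y ≤_) (m+n∸m≡n (r + L) r) (∸-monoʳ-≤ K (≰⇒> y≰r+L))))
          (sym (window-far (≰⇒> y≰r+L)))

  window-complementary : ∀ {a b} → a < K → b < K → K ∣ a + b → window a ≡ window b
  window-complementary {a} {b} a<K b<K (divides zero a+b≡0)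
    rewrite m+n≡0⇒m≡0 a a+b≡0 | m+n≡0⇒n≡0 a a+b≡0 = refl
  window-complementary {zero}    {b} a<K b<K (divides 1 b≡K) = ⊥-elim (<-irrefl (trans b≡K (+-identityʳ K)) b<K)
  window-complementary {a@(suc _)} {b} a<K b<K (divides 1 a+b≡K) = begin
    window a        ≡⟨ window-reflect (s≤s z≤n) a<K ⟨
    window (K ∸ a)  ≡⟨ cong (λ s → window (s ∸ a)) (trans (sym (+-identityʳ K)) (sym a+b≡K)) ⟩
    window (a + b ∸ a) ≡⟨ cong window (m+n∸m≡n a b) ⟩
    window b        ∎
    where open ≡-Reasoning
  window-complementary {a} {b} a<K b<K (divides (suc (suc q)) a+b≡) =
    ⊥-elim (<⇒≱ (+-mono-< a<K b<K) (subst (K + K ≤_) (sym a+b≡) (+-monoʳ-≤ K (m≤m+n K (q * K)))))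

  offset : Fin K → Fin K → ℕ
  offset c x = (toℕ x + (K ∸ toℕ c)) % K

  K∣offset+offset : ∀ c x → K ∣ offset c x + offset x c
  K∣offset+offset c x = m%n≡0⇒n∣m _ K (begin
    (offset c x + offset x c) % K
      ≡⟨ %-distribˡ-+ (x′ + (K ∸ c′)) (c′ + (K ∸ x′)) K ⟨
    (x′ + (K ∸ c′) + (c′ + (K ∸ x′))) % K
      ≡⟨ cong (_% K) (solve 4 (λ x c p q → x :+ p :+ (c :+ q) := c :+ p :+ (x :+ q)) refl x′ c′ (K ∸ c′) (K ∸ x′)) ⟩
    (c′ + (K ∸ c′) + (x′ + (K ∸ x′))) % K
      ≡⟨ cong₂ (λ a b → (a + b) % K) (m+[n∸m]≡n (<⇒≤ (toℕ<n c))) (m+[n∸m]≡n (<⇒≤ (toℕ<n x))) ⟩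
    (K + K) % K                             ≡⟨ [m+n]%n≡m%n K K ⟩
    K % K                                   ≡⟨ n%n≡0 K ⟩
    0                                       ∎)
    where
    open ≡-Reasoning
    open +-*-Solver
    c′ = toℕ c
    x′ = toℕ x

  offset-self : ∀ c → offset c c ≡ 0
  offset-self c = trans (cong (_% K) (m+[n∸m]≡n (<⇒≤ (toℕ<n c)))) (n%n≡0 K)

  graph : Graph K
  graph = record
    { adj   = λ c x → window (offset c x)
    ; sym   = λ c x → window-complementary (m%n<n (toℕ x + (K ∸ toℕ c)) K) (m%n<n (toℕ c + (K ∸ toℕ x)) K)
                                           (K∣offset+offset c x)
    ; irref = λ c → cong window (offset-self c) }

  degree-graph : ∀ c → degree graph c ≡ r + r
  degree-graph c = begin
    count (λ x → window (offset c x))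
      ≡⟨ sum-cong-≗ {K} (λ x → cong (indicator ∘ window) (toℕ-fromℕ< (m%n<n (toℕ x + s) K))) ⟨
    ∑[ x < K ] f (rotate s x)
      ≡⟨ ∑-permute f (permutation (rotate s) (rotate (toℕ c)) (rotate-inverse c+s≡K) (rotate-inverse s+c≡K)) ⟨
    sum f                               ≡⟨ count-window ⟩
    r + r                               ∎
    where
    open ≡-Reasoning
    s = K ∸ toℕ c
    f : Fin K → ℕ
    f = indicator ∘ window ∘ toℕ
    s+c≡K : s + toℕ c ≡ K
    s+c≡K = m∸n+n≡m (<⇒≤ (toℕ<n c))
    c+s≡K : toℕ c + s ≡ K
    c+s≡K = trans (+-comm (toℕ c) s) s+c≡K

  degree-complement-graph : ∀ c → degree (complement graph) c ≡ L
  degree-complement-graph c = +-cancelʳ-≡ (r + r + 1) h L (begin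
    h + (r + r + 1)          ≡⟨ +-assoc h (r + r) 1 ⟨
    h + (r + r) + 1          ≡⟨ cong (λ d → h + d + 1) (degree-graph c) ⟨
    h + degree graph c + 1   ≡⟨ degree-complement graph c ⟩
    suc (r + L + r)          ≡⟨ solve 2 (λ r L → con 1 :+ (r :+ L :+ r) := L :+ (r :+ r :+ con 1)) refl r L ⟩
    L + (r + r + 1)          ∎)
    where
    open ≡-Reasoning
    open +-*-Solver
    h = degree (complement graph) c

not-arrows-below : ∀ r n₁ n₂ {M} → M < 2 + (r + r) + n₁
  → ¬ Arrows M (StarVertex (2 + (r + r))) (StarEdge (2 + (r + r))) (DSVertex n₁ n₂) (DSEdge n₁ n₂)
not-arrows-below r n₁ n₂ M<N arrows with arrows-mono M≤K arrows (CyclePower.graph r n₁)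
  where
  M≤K = ≤-trans (s≤s⁻¹ M<N) (≤-reflexive (cong suc (solve 2 (λ r n → r :+ r :+ n := r :+ n :+ r) refl r n₁)))
    where open +-*-Solver
... | inj₁ star with c , big ← degree-of-star (CyclePower.graph r n₁) star =
  1+n≰n (≤-trans (n≤1+n _) (subst (2 + (r + r) ≤_) (CyclePower.degree-graph r n₁ c) big))
... | inj₂ double-star with c , big ← degree-of-double-star (complement (CyclePower.graph r n₁)) double-star =
  1+n≰n (subst (suc n₁ ≤_) (CyclePower.degree-complement-graph r n₁ c) big)

-- Parity and the numerical condition

2-prime : Prime 2
2-prime = from-yes (prime? 2)

2∣r+r : ∀ r → 2 ∣ r + r
2∣r+r r = divides r (solve 1 (λ r → r :+ r := r :* con 2) refl r)
  where open +-*-Solver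

odd-* : ∀ {a b} → ¬ 2 ∣ a → ¬ 2 ∣ b → ¬ 2 ∣ a * b
odd-* {a} {b} odd-a odd-b 2∣ab = [ odd-a , odd-b ] (euclidsLemma a b 2-prime 2∣ab)

odd-suc-double : ∀ r → ¬ 2 ∣ suc (r + r)
odd-suc-double r 2∣ with () ← ∣1⇒≡1 (∣m+n∣m⇒∣n (subst (2 ∣_) (+-comm 1 (r + r)) 2∣) (2∣r+r r))

odd-≥3-form : ∀ m → ¬ 2 ∣ m → 3 ≤ m → ∃ λ r → m ≡ 3 + (r + r)
odd-≥3-form 1 _ (s≤s ())
odd-≥3-form 2 _ (s≤s (s≤s ()))
odd-≥3-form 3 _ _ = 0 , refl
odd-≥3-form 4 odd _ = ⊥-elim (odd (divides 2 refl))
odd-≥3-form (suc (suc (suc (suc (suc m))))) odd _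
  with r , m≡ ← odd-≥3-form (3 + m) (odd ∘ ∣m∣n⇒∣m+n (divides 1 refl)) (s≤s (s≤s (s≤s z≤n)))
  = suc r , trans (cong (2 +_) m≡) (cong (4 +_) (sym (+-suc r r)))

-- The paper's condition n₁ > m − 5 + n₂ + (n₂ − 1)² / (m − 2 − n₂) in the variables d = m − 3 and a = n₂ − 1.
paper-bound⇒d²< : ∀ d a n → a < d → (3 + d + suc a) * (d ∸ a) + a ^ 2 < (n + 5) * (d ∸ a)
  → d * d < suc (d ∸ suc a) * suc n
paper-bound⇒d²< d a n a<d bound with o , refl ← m≤n⇒∃[o]m+o≡n a<d
  rewrite m+n∸m≡n a o | +-∸-assoc 1 (m≤m+n a o) | m+n∸m≡n a o =
  +-cancelʳ-< (4 * suc o) (suc (a + o) * suc (a + o)) (suc o * suc n) (subst₂ _<_ (lhs a o) (rhs n o) bound)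
  where
  open +-*-Solver
  lhs : ∀ a o → (3 + suc (a + o) + suc a) * suc o + a ^ 2 ≡ suc (a + o) * suc (a + o) + 4 * suc o
  lhs = solve 2 (λ a o → (con 3 :+ (con 1 :+ a :+ o) :+ (con 1 :+ a)) :* (con 1 :+ o) :+ a :^ 2
                         := (con 1 :+ a :+ o) :* (con 1 :+ a :+ o) :+ con 4 :* (con 1 :+ o)) refl
  rhs : ∀ n o → (n + 5) * suc o ≡ suc o * suc n + 4 * suc o
  rhs = solve 2 (λ n o → (n :+ con 5) :* (con 1 :+ o) := (con 1 :+ o) :* (con 1 :+ n) :+ con 4 :* (con 1 :+ o)) refl

theorem4p2 : (m n₁ n₂ : ℕ) → 1 ≤ m → 1 ≤ n₁ → 1 ≤ n₂
    → m ∸ 2 ≤ n₁ → n₂ < m ∸ 2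
    → ¬ (2 ∣ m * n₁)
    → (m + n₂) * (m ∸ 2 ∸ n₂) + (n₂ ∸ 1) ^ 2 < (n₁ + 5) * (m ∸ 2 ∸ n₂)
    → RamseyNumberIs (StarVertex (m ∸ 1)) (StarEdge (m ∸ 1)) (DSVertex n₁ n₂) (DSEdge n₁ n₂) (m ∸ 1 + n₁)
theorem4p2 m n₁ (suc a) _ _ _ m∸2≤n₁ n₂<m∸2 odd bound
  with r , refl ← odd-≥3-form m (odd ∘ ∣m⇒∣m*n n₁) (m∸n≢0⇒n<m (m<n⇒n≢0 n₂<m∸2)) =
    s≤s z≤n
  , arrows-upper-bound (r + r) n₁ (suc a) n₂≤d (≤-trans n₂<m∸2 m∸2≤n₁)
      (odd-* odd-order (odd-suc-double r)) (paper-bound⇒d²< (r + r) a n₁ n₂≤d bound)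
  , λ M _ → not-arrows-below r n₁ (suc a)
  where
  n₂≤d : suc a ≤ r + r
  n₂≤d = s≤s⁻¹ n₂<m∸2
  odd-order : ¬ 2 ∣ 2 + (r + r) + n₁
  odd-order 2∣N = odd (∣n⇒∣m*n (3 + (r + r)) (∣m+n∣m⇒∣n 2∣N (∣m∣n⇒∣m+n (divides 1 refl) (2∣r+r r))))
theorem4p2 m n₁ zero _ _ () _ _ _ _
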